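{- Let $(\mathcal{A}_n(x))_{n\ge 0}$ be a sequence of Appell polynomials defined by $\sum_{n\ge0}\mathcal{A}_n(x)\frac{t^n}{n!}=F(t)e^{xt}$ with $F(0)=1$, where $\mathcal{A}_n:=\mathcal{A}_n(0)$ is a nonnegative integer for every $n$, so that $\mathcal{A}_n(x)=\sum_{k=0}^n\binom{n}{k}\mathcal{A}_{n-k}x^k\in\mathbb{Z}[x]$. Let $p$ be an odd prime and suppose there is an integer $t$ such that $\mathcal{A}_{n+p}\equiv t\,\mathcal{A}_n \pmod p$ for every integer $n\ge 0$. Let $m\ge 0$ and $s\ge 1$ be integers. Then for every polynomial $f(y)=\sum_{k} c_k y^k\in\mathbb{Z}[y]$, $$\sum_k c_k\,\mathcal{A}_{k+mp^s}(x)\equiv \left(x^{p^s}+t\right)^m\sum_k c_k\,\mathcal{A}_k(x)\pmod{p}.$$ Equivalently (taking $f(y)=y^n$), for every integer $n\ge 0$, $$\mathcal{A}_{n+mp^s}(x)\equiv \left(x^{p^s}+t\right)^m\mathcal{A}_n(x)\pmod p,$$ and in particular $\mathcal{A}_{mp^s}(x)\equiv \left(x^{p^s}+t\right)^m \pmod p$.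
   Context: A congruence $P(x)\equiv Q(x)\pmod p$ between polynomials with integer coefficients means that every coefficient of $P(x)-Q(x)$ is divisible by $p$. In umbral notation, with the umbra $\mathbf{A}$ defined by $\mathbf{A}^n=\mathcal{A}_n$ (extended linearly), the first congruence reads $(\mathbf{A}+x)^{mp^s}f(\mathbf{A}+x)\equiv (x^{p^s}+t)^m f(\mathbf{A}+x)$, since $(\mathbf{A}+x)^n=\mathcal{A}_n(x)$. -}

module Defs where

open import Data.Nat as ℕ using (ℕ; zero; suc; _∸_)
open import Data.Nat.Combinatorics using (_C_)
open import Data.Integer as ℤ using (ℤ; +_; _-_)
open import Data.Integer.Divisibility using (_∣_)
open import Relation.Nullary using (yes; no)
open import Data.List using (List; []; _∷_)

-- Polynomials in ℤ[x], represented by their coefficient sequences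
-- (coefficient of x^k at index k).  All polynomials built below have finite support.
Poly : Set
Poly = ℕ → ℤ

sumTo : ℕ → (ℕ → ℤ) → ℤ
sumTo zero    g = g 0
sumTo (suc n) g = sumTo n g ℤ.+ g (suc n)

zeroP : Poly
zeroP _ = + 0

oneP : Poly
oneP zero    = + 1
oneP (suc _) = + 0

constP : ℤ → Poly
constP c zero    = c
constP c (suc _) = + 0

monoP : ℕ → Poly
monoP e k with e ℕ.≟ k
... | yes _ = + 1
... | no  _ = + 0

_+P_ : Poly → Poly → Poly
(P +P Q) k = P k ℤ.+ Q k

scaleP : ℤ → Poly → Poly
scaleP c P k = c ℤ.* P k

_*P_ : Poly → Poly → Poly
(P *P Q) k = sumTo k (λ i → P i ℤ.* Q (k ∸ i))

_^P_ : Poly → ℕ → Poly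
P ^P zero    = oneP
P ^P suc m   = P *P (P ^P m)

_≡P_[mod_] : Poly → Poly → ℕ → Set
P ≡P Q [mod p ] = ∀ k → (+ p) ∣ (P k - Q k)

-- Appell polynomial: 𝒜_n(x) = Σ_{k=0}^n (n choose k) 𝒜_{n-k} x^k, where 𝒜 n = 𝒜_n(0).
-- (n C k = 0 for k > n, so the coefficient sequence has finite support.)
appell : (ℕ → ℕ) → ℕ → Poly
appell A n k = + ((n C k) ℕ.* A (n ∸ k))

-- For f(y) = Σ_k c_k y^k given by its coefficient list [c_0, c_1, ...],
-- sumWith f shift = Σ_k c_k 𝒜_{k + shift}(x).
sumWith : (ℕ → ℕ) → List ℤ → ℕ → Poly
sumWith A []       shift = zeroP
sumWith A (c ∷ cs) shift = scaleP c (appell A shift) +P sumWith A cs (suc shift)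

-- Write e = p ^ s and Q = x ^ e + t.  Modulo p, every inner binomial coefficient of e vanishes,
-- so (1 + y) ^ (N + e) ≡ (1 + y) ^ N (1 + y ^ e) coefficientwise; and A (n + e) ≡ t A n, by
-- iterating the hypothesis p ^ (s - 1) times and using Fermat's little theorem t ^ (p ^ (s - 1)) ≡ t.
-- Comparing coefficients of 𝒜_{N+e}(x) = Σ_k C(N+e,k) A(N+e-k) x^k then gives 𝒜_{N+e} ≡ Q 𝒜_N;
-- iterating this m times and summing against the coefficients of f proves the theorem.

module Submission where

open import Defs
open import Data.Nat using (ℕ; _+_; _*_; _^_; _≤_)
open import Data.Nat.Primality using (Prime)
open import Data.Integer using (ℤ; +_; _-_) renaming (_*_ to _*ℤ_)
open import Data.Integer.Divisibility using (_∣_)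
open import Data.List using (List)
open import Relation.Binary.PropositionalEquality using (_≡_; _≢_)

open import Data.Nat as ℕ using (zero; suc; _∸_; _<_; pred; NonZero; s≤s; z≤n)
import Data.Nat.Properties as ℕ
open import Data.Nat.Combinatorics using (_C_; nCn≡1; nC1≡n; k>n⇒nCk≡0; nCk+nC[k+1]≡[n+1]C[k+1])
import Data.Nat.Divisibility as ℕ
open import Data.Nat.Primality using (prime⇒nonZero; euclidsLemma)
open import Data.Nat.Tactic.RingSolver as ℕ-Solver using ()
open import Data.Integer as ℤ using (0ℤ; 1ℤ) renaming (_+_ to _+ℤ_; _^_ to _^ℤ_)
import Data.Integer.Properties as ℤ
open import Data.Integer.Divisibility.Signed as Signed using (∣ᵤ⇒∣; ∣⇒∣ᵤ)
open import Data.Integer.Tactic.RingSolver using (solve-∀)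
import Data.Integer.DivMod as ℤ
open import Data.Fin using (Fin; zero; suc; toℕ; inject₁)
import Data.Fin.Properties as Fin
open import Data.Vec.Functional using (init; last; tail)
open import Data.List using ([]; _∷_)
open import Data.Sum using (inj₁; inj₂)
open import Data.Empty using (⊥-elim)
open import Function using (_∘_)
open import Relation.Nullary using (¬_; yes; no)
open import Relation.Binary.Bundles using (Setoid)
open import Algebra.Bundles using (CommutativeSemiring)
open import Algebra.Properties.CommutativeSemigroup ℤ.*-commutativeSemigroup using (x∙yz≈y∙xz)
open import Relation.Binary.Structures using (IsEquivalence)
import Relation.Binary.Reasoning.Setoid
open import Relation.Binary.PropositionalEquality
  using (refl; sym; trans; cong; cong₂; subst; module ≡-Reasoning)

module Congruence (n : ℕ) where

  -- A record, so that a and b can be recovered from a ≈ b by unification.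
  infix 4 _≈_
  record _≈_ (a b : ℤ) : Set where
    constructor mk≈
    field divides-difference : + n Signed.∣ a - b
  open _≈_ public

  private
    transport : ∀ {a b} → a ≡ b → + n Signed.∣ a → + n Signed.∣ b
    transport refl d = d

  ≈-reflexive : ∀ {a b} → a ≡ b → a ≈ b
  ≈-reflexive {a} refl = mk≈ (transport (sym (ℤ.+-inverseʳ a)) (Signed.∣n⇒∣m*n 0ℤ Signed.∣-refl))

  ≈-refl : ∀ {a} → a ≈ a
  ≈-refl = ≈-reflexive refl

  ≈-sym : ∀ {a b} → a ≈ b → b ≈ a
  ≈-sym {a} {b} (mk≈ d) = mk≈ (transport (negate a b) (Signed.∣m⇒∣-m d))
    where
    negate : ∀ a b → ℤ.- (a - b) ≡ b - a
    negate = solve-∀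

  ≈-trans : ∀ {a b c} → a ≈ b → b ≈ c → a ≈ c
  ≈-trans {a} {b} {c} (mk≈ d) (mk≈ e) = mk≈ (transport (telescope a b c) (Signed.∣m∣n⇒∣m+n d e))
    where
    telescope : ∀ a b c → (a - b) +ℤ (b - c) ≡ a - c
    telescope = solve-∀

  ≈-isEquivalence : IsEquivalence _≈_
  ≈-isEquivalence = record { refl = ≈-refl ; sym = ≈-sym ; trans = ≈-trans }

  ≈-setoid : Setoid _ _
  ≈-setoid = record { isEquivalence = ≈-isEquivalence }

  module ≈-Reasoning = Relation.Binary.Reasoning.Setoid ≈-setoid

  +-cong : ∀ {a b c d} → a ≈ b → c ≈ d → a +ℤ c ≈ b +ℤ d
  +-cong {a} {b} {c} {d} (mk≈ x) (mk≈ y) = mk≈ (transport (regroup a b c d) (Signed.∣m∣n⇒∣m+n x y))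
    where
    regroup : ∀ a b c d → (a - b) +ℤ (c - d) ≡ (a +ℤ c) - (b +ℤ d)
    regroup = solve-∀

  *-cong : ∀ {a b c d} → a ≈ b → c ≈ d → a *ℤ c ≈ b *ℤ d
  *-cong {a} {b} {c} {d} (mk≈ x) (mk≈ y) =
    mk≈ (transport (regroup a b c d) (Signed.∣m∣n⇒∣m+n (Signed.∣m⇒∣m*n c x) (Signed.∣n⇒∣m*n b y)))
    where
    regroup : ∀ a b c d → (a - b) *ℤ c +ℤ b *ℤ (c - d) ≡ a *ℤ c - b *ℤ d
    regroup = solve-∀

  ∣⇒≈0 : ∀ {a} → + n Signed.∣ a → a ≈ 0ℤ
  ∣⇒≈0 {a} d = mk≈ (transport (sym (ℤ.+-identityʳ a)) d)

  a+q*n≈a : ∀ a q → a +ℤ q *ℤ + n ≈ a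
  a+q*n≈a a q = mk≈ (transport (cancel a (q *ℤ + n)) (Signed.∣n⇒∣m*n q Signed.∣-refl))
    where
    cancel : ∀ a m → m ≡ (a +ℤ m) - a
    cancel = solve-∀

  ^-cong : ∀ {a b} k → a ≈ b → a ^ℤ k ≈ b ^ℤ k
  ^-cong zero    _   = ≈-refl
  ^-cong (suc k) a≈b = *-cong a≈b (^-cong k a≈b)

  ≈-iterate : (a : ℕ → ℤ) (f : ℕ) (u : ℤ) → (∀ j → a (j + f) ≈ u *ℤ a j) →
              ∀ c j → a (j + c * f) ≈ u ^ℤ c *ℤ a j
  ≈-iterate a f u step zero j = ≈-reflexive (trans (cong a (ℕ.+-identityʳ j)) (sym (ℤ.*-identityˡ (a j))))
  ≈-iterate a f u step (suc c) j = begin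
    a (j + (f + c * f))   ≡⟨ cong a (regroup j f c) ⟩
    a ((j + c * f) + f)   ≈⟨ step (j + c * f) ⟩
    u *ℤ a (j + c * f)    ≈⟨ *-cong (≈-refl {u}) (≈-iterate a f u step c j) ⟩
    u *ℤ (u ^ℤ c *ℤ a j)  ≡⟨ sym (ℤ.*-assoc u (u ^ℤ c) (a j)) ⟩
    u ^ℤ suc c *ℤ a j     ∎
    where
    open ≈-Reasoning
    regroup : ∀ j f c → j + (f + c * f) ≡ (j + c * f) + f
    regroup = ℕ-Solver.solve-∀

  sumTo-resp-≈ : ∀ k {f g : ℕ → ℤ} → (∀ i → f i ≈ g i) → sumTo k f ≈ sumTo k g
  sumTo-resp-≈ zero    f≈g = f≈g 0
  sumTo-resp-≈ (suc k) f≈g = +-cong (sumTo-resp-≈ k f≈g) (f≈g (suc k))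

  *P-respˡ-≈ : ∀ P {Q Q′} k → (∀ i → Q i ≈ Q′ i) → (P *P Q) k ≈ (P *P Q′) k
  *P-respˡ-≈ P k Q≈Q′ = sumTo-resp-≈ k (λ i → *-cong (≈-refl {P i}) (Q≈Q′ (k ∸ i)))

C-absorption : ∀ n k → suc k * (suc n C suc k) ≡ suc n * (n C k)
C-absorption zero    zero    = refl
C-absorption zero    (suc k) = ℕ.*-zeroʳ (suc (suc k))
C-absorption (suc n) zero    = trans (ℕ.*-identityˡ _) (trans (nC1≡n (2 + n)) (sym (ℕ.*-identityʳ (2 + n))))
C-absorption (suc n) (suc k) = begin
  (2 + k) * ((2 + n) C (2 + k))                  ≡⟨ cong ((2 + k) *_) (sym (nCk+nC[k+1]≡[n+1]C[k+1] (suc n) (suc k))) ⟩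
  (2 + k) * (a + b)                              ≡⟨ expand k a b ⟩
  (1 + k) * a + a + (2 + k) * b                  ≡⟨ cong₂ (λ u v → u + a + v) (C-absorption n k) (C-absorption n (suc k)) ⟩
  (1 + n) * (n C k) + a + (1 + n) * (n C suc k)  ≡⟨ collect n (n C k) a (n C suc k) ⟩
  (1 + n) * (n C k + n C suc k) + a              ≡⟨ cong (λ u → (1 + n) * u + a) (nCk+nC[k+1]≡[n+1]C[k+1] n k) ⟩
  (1 + n) * a + a                                ≡⟨ ℕ.+-comm ((1 + n) * a) a ⟩
  (2 + n) * a                                    ∎
  where
  open ≡-Reasoning
  a = suc n C suc k
  b = suc n C suc (suc k)
  expand : ∀ k a b → (2 + k) * (a + b) ≡ (1 + k) * a + a + (2 + k) * b
  expand = ℕ-Solver.solve-∀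
  collect : ∀ n x a y → (1 + n) * x + a + (1 + n) * y ≡ (1 + n) * (x + y) + a
  collect = ℕ-Solver.solve-∀

n∣k*[nCk] : ∀ n k .{{_ : NonZero n}} → n ℕ.∣ k * (n C k)
n∣k*[nCk] (suc n) zero    = suc n ℕ.∣0
n∣k*[nCk] (suc n) (suc k) = subst (suc n ℕ.∣_) (sym (C-absorption n k)) (ℕ.m∣m*n (n C k))

C-pascal : ∀ n k .{{_ : NonZero k}} → + (suc n C k) ≡ + (n C pred k) +ℤ + (n C k)
C-pascal n (suc k) = trans (cong +_ (sym (nCk+nC[k+1]≡[n+1]C[k+1] n k))) (ℤ.pos-+ (n C k) (n C suc k))

-- Unlike ℕ.+-∸-comm this needs no k ≤ n: otherwise n C k = 0.
nCk*-+-∸-comm : ∀ n m k (g : ℕ → ℤ) → + (n C k) *ℤ g (n + m ∸ k) ≡ + (n C k) *ℤ g (n ∸ k + m)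
nCk*-+-∸-comm n m k g with k ℕ.≤? n
... | yes k≤n = cong (λ i → + (n C k) *ℤ g i) (ℕ.+-∸-comm m k≤n)
... | no  k≰n rewrite k>n⇒nCk≡0 (ℕ.≰⇒> k≰n) = refl

-- (1 + y) ^ e ≡ 1 + y ^ e modulo n
infix 4 _∣InnerBinomials_
_∣InnerBinomials_ : ℕ → ℕ → Set
n ∣InnerBinomials e = ∀ k → 0 < k → k < e → n ℕ.∣ e C k

module _ {p} (p-prime : Prime p) where

  private instance
    p-nonZero : NonZero p
    p-nonZero = prime⇒nonZero p-prime

  p^s∣m*n∧p∤n⇒p^s∣m : ∀ s m n → p ^ s ℕ.∣ m * n → ¬ p ℕ.∣ n → p ^ s ℕ.∣ m
  p^s∣m*n∧p∤n⇒p^s∣m zero    m n _       _   = ℕ.1∣ m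
  p^s∣m*n∧p∤n⇒p^s∣m (suc s) m n p^s+1∣mn p∤n
    with euclidsLemma m n p-prime (ℕ.∣-trans (ℕ.m∣m*n (p ^ s)) p^s+1∣mn)
  ... | inj₂ p∣n = ⊥-elim (p∤n p∣n)
  ... | inj₁ (ℕ.divides q refl) =
    subst (p ^ suc s ℕ.∣_) (ℕ.*-comm p q)
      (ℕ.*-monoʳ-∣ p (p^s∣m*n∧p∤n⇒p^s∣m s q n
        (ℕ.*-cancelˡ-∣ p (subst (p ^ suc s ℕ.∣_) (regroup q p n) p^s+1∣mn)) p∤n))
    where
    regroup : ∀ q p n → q * p * n ≡ p * (q * n)
    regroup = ℕ-Solver.solve-∀

  p∣InnerBinomials[p^s] : ∀ s → p ∣InnerBinomials p ^ s
  p∣InnerBinomials[p^s] s (suc k) _ k<p^s with p ℕ.∣? (p ^ s C suc k)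
  ... | yes p∣C = p∣C
  ... | no  p∤C = ⊥-elim (ℕ.<⇒≱ k<p^s (ℕ.∣⇒≤ (p^s∣m*n∧p∤n⇒p^s∣m s (suc k) _ p^s∣kC p∤C)))
    where
    instance _ = ℕ.m^n≢0 p s
    p^s∣kC : p ^ s ℕ.∣ suc k * (p ^ s C suc k)
    p^s∣kC = n∣k*[nCk] (p ^ s) (suc k)

module _ {n} .{{_ : NonZero n}} where

  open Congruence n
  open CommutativeSemiring ℤ.+-*-commutativeSemiring using (+-monoid; semiring)
  open import Algebra.Properties.CommutativeSemiring.Binomial ℤ.+-*-commutativeSemiring using (theorem)
  open import Algebra.Properties.Monoid.Sum +-monoid using (sum; sum-init-last)
  open import Algebra.Properties.Monoid.Mult +-monoid using (_×_)
  open import Algebra.Properties.Semiring.Exp semiring using () renaming (_^_ to _^ˢ_)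

  private
    ^ˢ≡^ : ∀ a k → a ^ˢ k ≡ a ^ℤ k
    ^ˢ≡^ a zero    = refl
    ^ˢ≡^ a (suc k) = cong (a *ℤ_) (^ˢ≡^ a k)

    ×≡* : ∀ k a → k × a ≡ + k *ℤ a
    ×≡* zero    a = refl
    ×≡* (suc k) a = begin
      a +ℤ k × a           ≡⟨ cong (_+ℤ_ a) (×≡* k a) ⟩
      a +ℤ + k *ℤ a        ≡⟨ cong (_+ℤ (+ k *ℤ a)) (ℤ.*-identityˡ a) ⟨
      1ℤ *ℤ a +ℤ + k *ℤ a  ≡⟨ ℤ.*-distribʳ-+ a 1ℤ (+ k) ⟨
      (1ℤ +ℤ + k) *ℤ a     ≡⟨ cong (_*ℤ a) (ℤ.pos-+ 1 k) ⟨
      + suc k *ℤ a         ∎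
      where open ≡-Reasoning

    ×≈0 : ∀ k a → n ℕ.∣ k → k × a ≈ 0ℤ
    ×≈0 k a n∣k =
      ∣⇒≈0 (subst (+ n Signed.∣_) (sym (×≡* k a)) (Signed.∣m⇒∣m*n a (∣ᵤ⇒∣ {+ n} {+ k} n∣k)))

    sum≈0 : ∀ {k} (f : Fin k → ℤ) → (∀ i → f i ≈ 0ℤ) → sum f ≈ 0ℤ
    sum≈0 {zero}  f f≈0 = ≈-refl
    sum≈0 {suc k} f f≈0 = +-cong (f≈0 zero) (sum≈0 (tail f) (f≈0 ∘ suc))

  frobenius-+1 : ∀ e .{{_ : NonZero e}} → n ∣InnerBinomials e → ∀ a → (a +ℤ 1ℤ) ^ℤ e ≈ a ^ℤ e +ℤ 1ℤ
  frobenius-+1 (suc q) n∣C a = begin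
    (a +ℤ 1ℤ) ^ℤ suc q                                ≡⟨ sym (^ˢ≡^ (a +ℤ 1ℤ) (suc q)) ⟩
    (a +ℤ 1ℤ) ^ˢ suc q                                ≡⟨ theorem (suc q) a 1ℤ ⟩
    T zero +ℤ sum (tail T)                            ≡⟨ cong (_+ℤ_ (T zero)) (sum-init-last (tail T)) ⟩
    T zero +ℤ (sum (init (tail T)) +ℤ last (tail T))  ≈⟨ +-cong (≈-reflexive first) (+-cong inner≈0 (≈-reflexive final)) ⟩
    1ℤ +ℤ (0ℤ +ℤ a ^ℤ suc q)                          ≡⟨ cong (_+ℤ_ 1ℤ) (ℤ.+-identityˡ (a ^ℤ suc q)) ⟩
    1ℤ +ℤ a ^ℤ suc q                                  ≡⟨ ℤ.+-comm 1ℤ (a ^ℤ suc q) ⟩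
    a ^ℤ suc q +ℤ 1ℤ                                  ∎
    where
    open ≈-Reasoning
    T : Fin (suc (suc q)) → ℤ
    T k = (suc q C toℕ k) × (a ^ˢ toℕ k *ℤ 1ℤ ^ˢ (suc q ∸ toℕ k))
    first : T zero ≡ 1ℤ
    first = trans (ℤ.+-identityʳ _) (trans (ℤ.*-identityˡ _) (trans (^ˢ≡^ 1ℤ (suc q)) (ℤ.^-zeroˡ (suc q))))
    final : last (tail T) ≡ a ^ℤ suc q
    final rewrite Fin.toℕ-fromℕ q | nCn≡1 (suc q) | ℕ.n∸n≡0 q =
      trans (ℤ.+-identityʳ _) (trans (ℤ.*-identityʳ _) (^ˢ≡^ a (suc q)))
    inner≈0 : sum (init (tail T)) ≈ 0ℤ
    inner≈0 = sum≈0 _ (λ i → ×≈0 _ _ (n∣C (suc (toℕ (inject₁ i))) (s≤s z≤n)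
                (s≤s (subst (_< q) (sym (Fin.toℕ-inject₁ i)) (Fin.toℕ<n i)))))

  fermat-little : ∀ e .{{_ : NonZero e}} → n ∣InnerBinomials e → ∀ a → a ^ℤ e ≈ a
  fermat-little e@(suc _) n∣C a = begin
    a ^ℤ e      ≈⟨ ^-cong e a≈r ⟩
    (+ r) ^ℤ e  ≈⟨ fermat-ℕ r ⟩
    + r         ≈⟨ a≈r ⟨
    a           ∎
    where
    open ≈-Reasoning
    r = a ℤ.%ℕ n
    a≈r : a ≈ + r
    a≈r = ≈-trans (≈-reflexive (ℤ.a≡a%ℕn+[a/ℕn]*n a n)) (a+q*n≈a (+ r) (a ℤ./ℕ n))
    fermat-ℕ : ∀ m → (+ m) ^ℤ e ≈ + m
    fermat-ℕ zero    = ≈-refl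
    fermat-ℕ (suc m) = begin
      (+ suc m) ^ℤ e    ≡⟨ cong (_^ℤ e) +suc ⟩
      (+ m +ℤ 1ℤ) ^ℤ e  ≈⟨ frobenius-+1 e n∣C (+ m) ⟩
      (+ m) ^ℤ e +ℤ 1ℤ  ≈⟨ +-cong (fermat-ℕ m) ≈-refl ⟩
      + m +ℤ 1ℤ         ≡⟨ +suc ⟨
      + suc m           ∎
      where
      +suc : + suc m ≡ + m +ℤ 1ℤ
      +suc = trans (cong +_ (ℕ.+-comm 1 m)) (ℤ.pos-+ m 1)

module _ where

  open ≡-Reasoning

  sumTo-cong : ∀ k {f g : ℕ → ℤ} → (∀ i → f i ≡ g i) → sumTo k f ≡ sumTo k g
  sumTo-cong zero    f≗g = f≗g 0
  sumTo-cong (suc k) f≗g = cong₂ _+ℤ_ (sumTo-cong k f≗g) (f≗g (suc k))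

  sumTo-distrib-+ : ∀ k (f g : ℕ → ℤ) → sumTo k (λ i → f i +ℤ g i) ≡ sumTo k f +ℤ sumTo k g
  sumTo-distrib-+ zero    f g = refl
  sumTo-distrib-+ (suc k) f g = begin
    sumTo k (λ i → f i +ℤ g i) +ℤ (f (suc k) +ℤ g (suc k))  ≡⟨ cong (_+ℤ (f (suc k) +ℤ g (suc k))) (sumTo-distrib-+ k f g) ⟩
    sumTo k f +ℤ sumTo k g +ℤ (f (suc k) +ℤ g (suc k))      ≡⟨ interchange (sumTo k f) (sumTo k g) (f (suc k)) (g (suc k)) ⟩
    sumTo (suc k) f +ℤ sumTo (suc k) g                      ∎
    where
    interchange : ∀ a b c d → a +ℤ b +ℤ (c +ℤ d) ≡ a +ℤ c +ℤ (b +ℤ d)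
    interchange = solve-∀

  *-distribˡ-sumTo : ∀ k a (f : ℕ → ℤ) → a *ℤ sumTo k f ≡ sumTo k (λ i → a *ℤ f i)
  *-distribˡ-sumTo zero    a f = refl
  *-distribˡ-sumTo (suc k) a f =
    trans (ℤ.*-distribˡ-+ a (sumTo k f) (f (suc k))) (cong (_+ℤ a *ℤ f (suc k)) (*-distribˡ-sumTo k a f))

  sumTo-suc : ∀ k (f : ℕ → ℤ) → sumTo (suc k) f ≡ f 0 +ℤ sumTo k (f ∘ suc)
  sumTo-suc zero    f = refl
  sumTo-suc (suc k) f = trans (cong (_+ℤ f (2 + k)) (sumTo-suc k f)) (ℤ.+-assoc (f 0) _ _)

  *P-suc : ∀ P Q k → (P *P Q) (suc k) ≡ P 0 *ℤ Q (suc k) +ℤ ((P ∘ suc) *P Q) k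
  *P-suc P Q k = sumTo-suc k (λ i → P i *ℤ Q (suc k ∸ i))

  *P-congʳ : ∀ {P P′} R k → (∀ i → P i ≡ P′ i) → (P *P R) k ≡ (P′ *P R) k
  *P-congʳ R k P≗P′ = sumTo-cong k (λ i → cong (_*ℤ R (k ∸ i)) (P≗P′ i))

  *P-distribʳ-+P : ∀ P Q R k → ((P +P Q) *P R) k ≡ (P *P R) k +ℤ (Q *P R) k
  *P-distribʳ-+P P Q R k =
    trans (sumTo-cong k (λ i → ℤ.*-distribʳ-+ (R (k ∸ i)) (P i) (Q i))) (sumTo-distrib-+ k _ _)

  *P-distribˡ-+P : ∀ P Q R k → (P *P (Q +P R)) k ≡ (P *P Q) k +ℤ (P *P R) k
  *P-distribˡ-+P P Q R k =
    trans (sumTo-cong k (λ i → ℤ.*-distribˡ-+ (P i) (Q (k ∸ i)) (R (k ∸ i)))) (sumTo-distrib-+ k _ _)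

  scaleP-*P : ∀ c P Q k → (scaleP c P *P Q) k ≡ c *ℤ (P *P Q) k
  scaleP-*P c P Q k =
    trans (sumTo-cong k (λ i → ℤ.*-assoc c (P i) (Q (k ∸ i)))) (sym (*-distribˡ-sumTo k c _))

  *P-scaleP : ∀ c P Q k → (P *P scaleP c Q) k ≡ c *ℤ (P *P Q) k
  *P-scaleP c P Q k = trans (sumTo-cong k (λ i → x∙yz≈y∙xz (P i) c (Q (k ∸ i)))) (sym (*-distribˡ-sumTo k c _))

  zeroP-*P : ∀ P k → (zeroP *P P) k ≡ 0ℤ
  zeroP-*P P zero    = refl
  zeroP-*P P (suc k) = trans (*P-suc zeroP P k) (trans (ℤ.+-identityˡ _) (zeroP-*P P k))

  *P-zeroP : ∀ P k → (P *P zeroP) k ≡ 0ℤ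
  *P-zeroP P zero    = ℤ.*-zeroʳ (P 0)
  *P-zeroP P (suc k) = trans (*P-suc P zeroP k) (cong₂ _+ℤ_ (ℤ.*-zeroʳ (P 0)) (*P-zeroP (P ∘ suc) k))

  constP-*P : ∀ c P k → (constP c *P P) k ≡ c *ℤ P k
  constP-*P c P zero    = refl
  constP-*P c P (suc k) =
    trans (*P-suc (constP c) P k) (trans (cong (c *ℤ P (suc k) +ℤ_) (zeroP-*P P k)) (ℤ.+-identityʳ _))

  oneP-*P : ∀ P k → (oneP *P P) k ≡ P k
  oneP-*P P k = trans (*P-congʳ P k oneP≗constP1) (trans (constP-*P 1ℤ P k) (ℤ.*-identityˡ (P k)))
    where
    oneP≗constP1 : ∀ i → oneP i ≡ constP 1ℤ i
    oneP≗constP1 zero    = refl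
    oneP≗constP1 (suc _) = refl

  *P-assoc : ∀ P Q R k → ((P *P Q) *P R) k ≡ (P *P (Q *P R)) k
  *P-assoc P Q R zero    = ℤ.*-assoc (P 0) (Q 0) (R 0)
  *P-assoc P Q R (suc k) = begin
    ((P *P Q) *P R) (suc k)
      ≡⟨ *P-suc (P *P Q) R k ⟩
    P 0 *ℤ Q 0 *ℤ R (suc k) +ℤ (((P *P Q) ∘ suc) *P R) k
      ≡⟨ cong (P 0 *ℤ Q 0 *ℤ R (suc k) +ℤ_) (*P-congʳ R k (*P-suc P Q)) ⟩
    P 0 *ℤ Q 0 *ℤ R (suc k) +ℤ ((scaleP (P 0) (Q ∘ suc) +P ((P ∘ suc) *P Q)) *P R) k
      ≡⟨ cong (P 0 *ℤ Q 0 *ℤ R (suc k) +ℤ_) (*P-distribʳ-+P (scaleP (P 0) (Q ∘ suc)) ((P ∘ suc) *P Q) R k) ⟩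
    P 0 *ℤ Q 0 *ℤ R (suc k) +ℤ ((scaleP (P 0) (Q ∘ suc) *P R) k +ℤ (((P ∘ suc) *P Q) *P R) k)
      ≡⟨ cong (P 0 *ℤ Q 0 *ℤ R (suc k) +ℤ_) (cong₂ _+ℤ_ (scaleP-*P (P 0) (Q ∘ suc) R k) (*P-assoc (P ∘ suc) Q R k)) ⟩
    P 0 *ℤ Q 0 *ℤ R (suc k) +ℤ (P 0 *ℤ ((Q ∘ suc) *P R) k +ℤ ((P ∘ suc) *P (Q *P R)) k)
      ≡⟨ factor (P 0) (Q 0) (R (suc k)) (((Q ∘ suc) *P R) k) (((P ∘ suc) *P (Q *P R)) k) ⟩
    P 0 *ℤ (Q 0 *ℤ R (suc k) +ℤ ((Q ∘ suc) *P R) k) +ℤ ((P ∘ suc) *P (Q *P R)) k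
      ≡⟨ cong (λ x → P 0 *ℤ x +ℤ ((P ∘ suc) *P (Q *P R)) k) (*P-suc Q R k) ⟨
    P 0 *ℤ (Q *P R) (suc k) +ℤ ((P ∘ suc) *P (Q *P R)) k
      ≡⟨ *P-suc P (Q *P R) k ⟨
    (P *P (Q *P R)) (suc k)
      ∎
    where
    factor : ∀ a b c x y → a *ℤ b *ℤ c +ℤ (a *ℤ x +ℤ y) ≡ a *ℤ (b *ℤ c +ℤ x) +ℤ y
    factor = solve-∀

  monoP-suc : ∀ e k → monoP (suc e) (suc k) ≡ monoP e k
  monoP-suc e k with e ℕ.≟ k | suc e ℕ.≟ suc k
  ... | yes _   | yes _     = refl
  ... | no  _   | no  _     = refl
  ... | yes e≡k | no  e+1≢k+1 = ⊥-elim (e+1≢k+1 (cong suc e≡k))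
  ... | no  e≢k | yes e+1≡k+1 = ⊥-elim (e≢k (ℕ.suc-injective e+1≡k+1))

  monoP-suc-*P : ∀ e P k → (monoP (suc e) *P P) (suc k) ≡ (monoP e *P P) k
  monoP-suc-*P e P k = begin
    (monoP (suc e) *P P) (suc k)          ≡⟨ *P-suc (monoP (suc e)) P k ⟩
    0ℤ +ℤ ((monoP (suc e) ∘ suc) *P P) k  ≡⟨ ℤ.+-identityˡ _ ⟩
    ((monoP (suc e) ∘ suc) *P P) k        ≡⟨ *P-congʳ P k (monoP-suc e) ⟩
    (monoP e *P P) k                      ∎

  monoP-*P-< : ∀ e P k → k < e → (monoP e *P P) k ≡ 0ℤ
  monoP-*P-< (suc e) P zero    _         = refl
  monoP-*P-< (suc e) P (suc k) (s≤s k<e) = trans (monoP-suc-*P e P k) (monoP-*P-< e P k k<e)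

  monoP-*P-+ : ∀ e P j → (monoP e *P P) (j + e) ≡ P j
  monoP-*P-+ zero    P j = trans (*P-congʳ P (j + 0) monoP0≗oneP) (trans (oneP-*P P (j + 0)) (cong P (ℕ.+-identityʳ j)))
    where
    monoP0≗oneP : ∀ i → monoP 0 i ≡ oneP i
    monoP0≗oneP zero    = refl
    monoP0≗oneP (suc _) = refl
  monoP-*P-+ (suc e) P j = begin
    (monoP (suc e) *P P) (j + suc e)    ≡⟨ cong (monoP (suc e) *P P) (ℕ.+-suc j e) ⟩
    (monoP (suc e) *P P) (suc (j + e))  ≡⟨ monoP-suc-*P e P (j + e) ⟩
    (monoP e *P P) (j + e)              ≡⟨ monoP-*P-+ e P j ⟩
    P j                                 ∎

<-or-+ : ∀ e {P : ℕ → Set} → (∀ k → k < e → P k) → (∀ j → P (j + e)) → ∀ k → P k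
<-or-+ e {P} below above k with k ℕ.<? e
... | yes k<e = below k k<e
... | no  k≮e = subst P (ℕ.m∸n+n≡m (ℕ.≮⇒≥ k≮e)) (above (k ∸ e))

-- (1 + y) ^ (N + e) ≡ (1 + y) ^ N (1 + y ^ e), coefficientwise.
module BinomialShift {p e} .{{_ : NonZero e}} (p∣C : p ∣InnerBinomials e) where

  open Congruence p
  open ≈-Reasoning

  C-shift-< : ∀ N k → k < e → + ((N + e) C k) ≈ + (N C k)
  C-shift-< zero    zero    _   = ≈-refl
  C-shift-< zero    (suc k) k<e = ∣⇒≈0 (∣ᵤ⇒∣ {+ p} {+ (e C suc k)} (p∣C (suc k) (s≤s z≤n) k<e))
  C-shift-< (suc N) zero    _   = ≈-refl
  C-shift-< (suc N) (suc k) k<e = begin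
    + (suc (N + e) C suc k)                 ≡⟨ C-pascal (N + e) (suc k) ⟩
    + ((N + e) C k) +ℤ + ((N + e) C suc k)  ≈⟨ +-cong (C-shift-< N k (ℕ.<-trans (ℕ.n<1+n k) k<e)) (C-shift-< N (suc k) k<e) ⟩
    + (N C k) +ℤ + (N C suc k)              ≡⟨ C-pascal N (suc k) ⟨
    + (suc N C suc k)                       ∎

  C-shift-+ : ∀ N j → + ((N + e) C (j + e)) ≈ + (N C (j + e)) +ℤ + (N C j)
  C-shift-+ zero zero
    rewrite nCn≡1 e | k>n⇒nCk≡0 {0} {e} (ℕ.>-nonZero⁻¹ e) = ≈-refl
  C-shift-+ zero (suc j)
    rewrite k>n⇒nCk≡0 {e} {suc j + e} (s≤s (ℕ.m≤n+m e j)) = ≈-refl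
  C-shift-+ (suc N) zero = begin
    + (suc (N + e) C e)                         ≡⟨ C-pascal (N + e) e ⟩
    + ((N + e) C pred e) +ℤ + ((N + e) C e)     ≈⟨ +-cong (C-shift-< N (pred e) pred<e) (C-shift-+ N zero) ⟩
    + (N C pred e) +ℤ (+ (N C e) +ℤ + (N C 0))  ≡⟨ ℤ.+-assoc (+ (N C pred e)) (+ (N C e)) (+ (N C 0)) ⟨
    + (N C pred e) +ℤ + (N C e) +ℤ + (N C 0)    ≡⟨ cong (_+ℤ + (N C 0)) (C-pascal N e) ⟨
    + (suc N C e) +ℤ + (suc N C 0)              ∎
    where
    pred<e : pred e < e
    pred<e = ℕ.≤-reflexive (ℕ.suc-pred e)
  C-shift-+ (suc N) (suc j) = begin
    + (suc (N + e) C suc (j + e))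
      ≡⟨ C-pascal (N + e) (suc (j + e)) ⟩
    + ((N + e) C (j + e)) +ℤ + ((N + e) C (suc j + e))
      ≈⟨ +-cong (C-shift-+ N j) (C-shift-+ N (suc j)) ⟩
    (+ (N C (j + e)) +ℤ + (N C j)) +ℤ (+ (N C (suc j + e)) +ℤ + (N C suc j))
      ≡⟨ interchange (+ (N C (j + e))) (+ (N C j)) (+ (N C (suc j + e))) (+ (N C suc j)) ⟩
    (+ (N C (j + e)) +ℤ + (N C suc (j + e))) +ℤ (+ (N C j) +ℤ + (N C suc j))
      ≡⟨ cong₂ _+ℤ_ (C-pascal N (suc (j + e))) (C-pascal N (suc j)) ⟨
    + (suc N C suc (j + e)) +ℤ + (suc N C suc j)
      ∎
    where
    interchange : ∀ a b c d → (a +ℤ b) +ℤ (c +ℤ d) ≡ (a +ℤ c) +ℤ (b +ℤ d)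
    interchange = solve-∀

module AppellShift (A : ℕ → ℕ) {p e} .{{_ : NonZero e}} (p∣C : p ∣InnerBinomials e) (t : ℤ)
  (A-shift : ∀ n → Congruence._≈_ p (+ A (n + e)) (t *ℤ + A n)) where

  open Congruence p
  open ≈-Reasoning
  open BinomialShift p∣C

  Q : Poly
  Q = monoP e +P constP t

  Q-*P : ∀ P k → (Q *P P) k ≡ (monoP e *P P) k +ℤ t *ℤ P k
  Q-*P P k = trans (*P-distribʳ-+P (monoP e) (constP t) P k) (cong ((monoP e *P P) k +ℤ_) (constP-*P t P k))

  appell-coeff : ∀ n k → appell A n k ≡ + (n C k) *ℤ + A (n ∸ k)
  appell-coeff n k = ℤ.pos-* (n C k) (A (n ∸ k))

  C*A-shift : ∀ N k → + (N C k) *ℤ + A (N + e ∸ k) ≈ t *ℤ appell A N k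
  C*A-shift N k = begin
    + (N C k) *ℤ + A (N + e ∸ k)     ≡⟨ nCk*-+-∸-comm N e k (+_ ∘ A) ⟩
    + (N C k) *ℤ + A (N ∸ k + e)     ≈⟨ *-cong (≈-refl {+ (N C k)}) (A-shift (N ∸ k)) ⟩
    + (N C k) *ℤ (t *ℤ + A (N ∸ k))  ≡⟨ x∙yz≈y∙xz (+ (N C k)) t (+ A (N ∸ k)) ⟩
    t *ℤ (+ (N C k) *ℤ + A (N ∸ k))  ≡⟨ cong (t *ℤ_) (appell-coeff N k) ⟨
    t *ℤ appell A N k                ∎

  appell-shift : ∀ N k → appell A (N + e) k ≈ (Q *P appell A N) k
  appell-shift N = <-or-+ e below above
    where
    R = appell A N
    below : ∀ k → k < e → appell A (N + e) k ≈ (Q *P R) k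
    below k k<e = begin
      appell A (N + e) k                  ≡⟨ appell-coeff (N + e) k ⟩
      + ((N + e) C k) *ℤ + A (N + e ∸ k)  ≈⟨ *-cong (C-shift-< N k k<e) (≈-refl {+ A (N + e ∸ k)}) ⟩
      + (N C k) *ℤ + A (N + e ∸ k)        ≈⟨ C*A-shift N k ⟩
      t *ℤ R k                            ≡⟨ ℤ.+-identityˡ (t *ℤ R k) ⟨
      0ℤ +ℤ t *ℤ R k                      ≡⟨ cong (_+ℤ t *ℤ R k) (monoP-*P-< e R k k<e) ⟨
      (monoP e *P R) k +ℤ t *ℤ R k        ≡⟨ Q-*P R k ⟨
      (Q *P R) k                          ∎
    above : ∀ j → appell A (N + e) (j + e) ≈ (Q *P R) (j + e)
    above j = begin
      appell A (N + e) (j + e)                   ≡⟨ appell-coeff (N + e) (j + e) ⟩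
      + ((N + e) C (j + e)) *ℤ a                 ≈⟨ *-cong (C-shift-+ N j) (≈-refl {a}) ⟩
      (+ (N C (j + e)) +ℤ + (N C j)) *ℤ a        ≡⟨ ℤ.*-distribʳ-+ a (+ (N C (j + e))) (+ (N C j)) ⟩
      + (N C (j + e)) *ℤ a +ℤ + (N C j) *ℤ a     ≈⟨ +-cong (C*A-shift N (j + e)) (≈-reflexive C*a≡Rj) ⟩
      t *ℤ R (j + e) +ℤ R j                      ≡⟨ ℤ.+-comm (t *ℤ R (j + e)) (R j) ⟩
      R j +ℤ t *ℤ R (j + e)                      ≡⟨ cong (_+ℤ t *ℤ R (j + e)) (monoP-*P-+ e R j) ⟨
      (monoP e *P R) (j + e) +ℤ t *ℤ R (j + e)   ≡⟨ Q-*P R (j + e) ⟨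
      (Q *P R) (j + e)                           ∎
      where
      a = + A (N + e ∸ (j + e))
      [N+e]∸[j+e]≡N∸j : N + e ∸ (j + e) ≡ N ∸ j
      [N+e]∸[j+e]≡N∸j = trans (cong₂ _∸_ (ℕ.+-comm N e) (ℕ.+-comm j e)) (ℕ.[m+n]∸[m+o]≡n∸o e N j)
      C*a≡Rj : + (N C j) *ℤ a ≡ R j
      C*a≡Rj = trans (cong (λ i → + (N C j) *ℤ + A i) [N+e]∸[j+e]≡N∸j) (sym (appell-coeff N j))

  appell-shift-power : ∀ m N k → appell A (N + m * e) k ≈ ((Q ^P m) *P appell A N) k
  appell-shift-power zero    N k =
    ≈-reflexive (trans (cong (λ i → appell A i k) (ℕ.+-identityʳ N)) (sym (oneP-*P (appell A N) k)))
  appell-shift-power (suc m) N k = begin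
    appell A (N + (e + m * e)) k       ≡⟨ cong (λ i → appell A i k) (regroup N e (m * e)) ⟩
    appell A (N + m * e + e) k         ≈⟨ appell-shift (N + m * e) k ⟩
    (Q *P appell A (N + m * e)) k      ≈⟨ *P-respˡ-≈ Q k (appell-shift-power m N) ⟩
    (Q *P ((Q ^P m) *P appell A N)) k  ≡⟨ *P-assoc Q (Q ^P m) (appell A N) k ⟨
    ((Q *P (Q ^P m)) *P appell A N) k  ∎
    where
    regroup : ∀ N e x → N + (e + x) ≡ N + x + e
    regroup = ℕ-Solver.solve-∀

  sumWith-shift : ∀ m f N k → sumWith A f (N + m * e) k ≈ ((Q ^P m) *P sumWith A f N) k
  sumWith-shift m []      N k = ≈-reflexive (sym (*P-zeroP (Q ^P m) k))
  sumWith-shift m (c ∷ f) N k = begin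
    c *ℤ appell A (N + m * e) k +ℤ sumWith A f (suc N + m * e) k
      ≈⟨ +-cong (*-cong (≈-refl {c}) (appell-shift-power m N k)) (sumWith-shift m f (suc N) k) ⟩
    c *ℤ (Qᵐ *P appell A N) k +ℤ (Qᵐ *P sumWith A f (suc N)) k
      ≡⟨ cong (_+ℤ (Qᵐ *P sumWith A f (suc N)) k) (*P-scaleP c Qᵐ (appell A N) k) ⟨
    (Qᵐ *P scaleP c (appell A N)) k +ℤ (Qᵐ *P sumWith A f (suc N)) k
      ≡⟨ *P-distribˡ-+P Qᵐ (scaleP c (appell A N)) (sumWith A f (suc N)) k ⟨
    (Qᵐ *P sumWith A (c ∷ f) N) k
      ∎
    where
    Qᵐ = Q ^P m

module _ {p} (p-prime : Prime p) where

  open Congruence p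
  open ≈-Reasoning

  private instance
    p-nonZero : NonZero p
    p-nonZero = prime⇒nonZero p-prime

  shift-p⇒shift-p^s : (a : ℕ → ℤ) (t : ℤ) → (∀ j → a (j + p) ≈ t *ℤ a j) →
                      ∀ s j → a (j + p ^ suc s) ≈ t *ℤ a j
  shift-p⇒shift-p^s a t shift-p s j = begin
    a (j + p * p ^ s)    ≡⟨ cong (λ i → a (j + i)) (ℕ.*-comm p (p ^ s)) ⟩
    a (j + p ^ s * p)    ≈⟨ ≈-iterate a p t shift-p (p ^ s) j ⟩
    t ^ℤ (p ^ s) *ℤ a j  ≈⟨ *-cong t^p^s≈t (≈-refl {a j}) ⟩
    t *ℤ a j             ∎
    where
    t^p^s≈t : t ^ℤ (p ^ s) ≈ t
    t^p^s≈t = fermat-little (p ^ s) {{ℕ.m^n≢0 p s}} (p∣InnerBinomials[p^s] p-prime s) t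

theorem1 : (A : ℕ → ℕ) → A 0 ≡ 1 →
    (p : ℕ) → Prime p → p ≢ 2 →
    (t : ℤ) → (∀ n → (+ p) ∣ ((+ A (n + p)) - (t *ℤ (+ A n)))) →
    (m s : ℕ) → 1 ≤ s →
    (f : List ℤ) →
    sumWith A f (m * p ^ s) ≡P ((monoP (p ^ s) +P constP t) ^P m) *P sumWith A f 0 [mod p ]
theorem1 A _ p p-prime _ t p∣A-shift m (suc s) _ f k =
  ∣⇒∣ᵤ (divides-difference (sumWith-shift m f 0 k))
  where
  open Congruence p
  instance
    p^s-nonZero : NonZero (p ^ suc s)
    p^s-nonZero = ℕ.m^n≢0 p (suc s) {{prime⇒nonZero p-prime}}
  A-shift : ∀ n → + A (n + p ^ suc s) ≈ t *ℤ + A n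
  A-shift = shift-p⇒shift-p^s p-prime (+_ ∘ A) t (λ n → mk≈ (∣ᵤ⇒∣ (p∣A-shift n))) s
  open AppellShift A (p∣InnerBinomials[p^s] p-prime (suc s)) t A-shift
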